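{- Let $\Gamma=\langle S\mid R\rangle$ be a finitely presented group and let $\ell$ be the maximal length of a word in $R$. Let $\Omega\subseteq\Sigma$ be finite sets and let $\varphi\colon S\to\mathrm{Sym}(\Omega)$ and $\psi\colon S\to\mathrm{Sym}(\Sigma)$ be such that $\varphi$ is an $\epsilon_1$-almost action of $\Gamma$ and $d_H(\varphi,\psi)\le\epsilon_2$. Then $\psi$ is an $(\epsilon_1+(\ell+1)\epsilon_2)$-almost action of $\Gamma$.
   Context: For finite sets $\Omega\subseteq\Sigma$, $\sigma\in\mathrm{Sym}(\Omega)$, $\sigma'\in\mathrm{Sym}(\Sigma)$: $d_H(\sigma,\sigma')=\Pr_{\star\in\Sigma}[\sigma.\star\neq\sigma'.\star]$ (uniform on $\Sigma$), where $\sigma.\star$ is an error symbol not in $\Sigma$ for $\star\notin\Omega$. For maps on $S$, $d_H(\varphi,\psi)=\max_{s\in S}d_H(\varphi(s),\psi(s))$. Maps $S\to\mathrm{Sym}(\cdot)$ are extended to words in the free group on $S$. The defect of $\varphi\colon S\to\mathrm{Sym}(\Omega)$ is $\mathrm{def}(\varphi)=\max_{r\in R}\Pr_{\star\in\Omega}[\varphi(r).\star\ne\star]$, and $\varphi$ is an $\epsilon$-almost action if $\mathrm{def}(\varphi)\le\epsilon$. -}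

module Defs where

open import Data.Nat as ℕ using (ℕ; zero; suc)
open import Data.Bool using (Bool; true; false)
open import Data.Fin using (Fin)
open import Data.Fin.Properties using (any?) renaming (_≟_ to _≟F_)
open import Data.Fin.Permutation using (Permutation′; _⟨$⟩ʳ_; _⟨$⟩ˡ_)
open import Data.Vec using (allFin; count)
open import Data.List using (List; []; _∷_; map; foldr; length)
import Data.List
open import Data.Maybe using (Maybe; just; nothing)
import Data.Maybe.Properties as MaybeP
open import Data.Product using (_×_; _,_; ∃)
open import Data.Integer using (+_)
open import Data.Rational using (ℚ; 0ℚ; _/_; _⊔_; _≤_; _+_; _*_)
open import Function using (_↣_; Injection)
open import Relation.Nullary using (Dec; yes; no; ¬_)
open import Relation.Nullary.Decidable using (¬?)
open import Relation.Unary using (Pred; Decidable)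
open import Relation.Binary.PropositionalEquality using (_≡_)

Sym : ℕ → Set
Sym n = Permutation′ n

-- Words in the free group on S = Fin k: letters (s , true) = s, (s , false) = s⁻¹.
Word : ℕ → Set
Word k = List (Fin k × Bool)

record Presentation : Set where
  field
    gens : ℕ
    rels : List (Word gens)
open Presentation public

-- Extension of φ : S → Sym(Fin n) to words (left action, rightmost letter acts first).
act : ∀ {k n} → (Fin k → Sym n) → Word k → Fin n → Fin n
act φ [] x = x
act φ ((s , true)  ∷ w) x = φ s ⟨$⟩ʳ act φ w x
act φ ((s , false) ∷ w) x = φ s ⟨$⟩ˡ act φ w x

-- Uniform probability on Fin m of a decidable event (convention: 0 if m = 0).
Pr : (m : ℕ) {P : Pred (Fin m) Agda.Primitive.lzero} → Decidable P → ℚ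
Pr zero    P? = 0ℚ
Pr (suc m) P? = (+ count P? (allFin (suc m))) / suc m

maxℚ : List ℚ → ℚ
maxℚ = foldr _⊔_ 0ℚ

maxℕ : List ℕ → ℕ
maxℕ = foldr ℕ._⊔_ 0

maxRelLength : Presentation → ℕ
maxRelLength P = maxℕ (map length (rels P))

defect : (P : Presentation) {n : ℕ} → (Fin (gens P) → Sym n) → ℚ
defect P {n} φ = maxℚ (map (λ r → Pr n (λ x → ¬? (act φ r x ≟F x))) (rels P))

AlmostAction : (P : Presentation) {n : ℕ} → ℚ → (Fin (gens P) → Sym n) → Set
AlmostAction P ε φ = defect P φ ≤ ε

-- Ω ⊆ Σ, with Ω = Fin n, Σ = Fin m, and the inclusion given by an injection ι.
-- σ.⋆ for σ ∈ Sym(Ω), ⋆ ∈ Σ : ι(σ(ω)) if ⋆ = ι(ω), the error symbol (nothing) otherwise.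
extAct : ∀ {n m} → (Fin n ↣ Fin m) → Sym n → Fin m → Maybe (Fin m)
extAct ι σ ⋆ with any? (λ ω → Injection.to ι ω ≟F ⋆)
... | yes (ω , _) = just (Injection.to ι (σ ⟨$⟩ʳ ω))
... | no _ = nothing

dH : ∀ {n m} → (Fin n ↣ Fin m) → Sym n → Sym m → ℚ
dH {n} {m} ι σ σ' =
  Pr m (λ ⋆ → ¬? (MaybeP.≡-dec _≟F_ (extAct ι σ ⋆) (just (σ' ⟨$⟩ʳ ⋆))))

dHmap : ∀ {k n m} → (Fin n ↣ Fin m) → (Fin k → Sym n) → (Fin k → Sym m) → ℚ
dHmap {k} ι φ ψ = maxℚ (Data.List.map (λ s → dH ι (φ s) (ψ s)) (Data.List.allFin k))

-- Fix a relator r and a point x of Σ whose ψ-trajectory under r meets no generator s at a point where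
-- φ(s) and ψ(s) disagree. Then x lies in Ω and the ψ-trajectory of x is the φ-trajectory of x, so if
-- ψ(r) moves x then φ(r) moves x. Counting, the points moved by ψ(r) are at most those moved by φ(r)
-- (a fraction ≤ ε₁ of |Ω| ≤ |Σ|) together with, for each of the |r| ≤ ℓ letters of r, the points
-- whose trajectory meets a disagreement of that letter; since the trajectory up to a letter is a
-- permutation of Σ, each such set has the size of a disagreement set, a fraction ≤ ε₂ of |Σ|.
module Submission where

open import Defs
open import Data.Nat using (ℕ) renaming (_+_ to _+ℕ_)
open import Data.Fin using (Fin)
open import Data.Integer using (+_)
open import Data.Rational using (ℚ; _≤_; _+_; _*_; _/_)
open import Function using (_↣_)

open import Level using (0ℓ)
open import Data.Nat as ℕ using (zero; suc; z≤n; s≤s)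
import Data.Nat.Properties as ℕP
open import Data.Fin using (zero; suc)
open import Data.Fin.Properties using (any?; ¬Fin0; injective⇒≤; suc-injective) renaming (_≟_ to _≟F_)
open import Data.Fin.Permutation as Perm using (Permutation′; _⟨$⟩ʳ_; _⟨$⟩ˡ_; _∘ₚ_)
open import Data.Bool using (Bool; true; false)
open import Data.Product using (_×_; _,_; ∃; proj₁)
open import Data.Sum using (_⊎_; inj₁; inj₂)
open import Data.Empty using (⊥; ⊥-elim)
open import Data.List using ([]; _∷_; map; length)
import Data.List as List
open import Data.List.Membership.Propositional using (_∈_)
open import Data.List.Membership.Propositional.Properties using (∈-allFin)
open import Data.List.Relation.Unary.Any using (here; there)
open import Data.Maybe using (just)
import Data.Maybe.Properties as MaybeP
open import Data.Vec using (count; tabulate)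
import Data.Integer as ℤ
import Data.Integer.Properties as ℤP
open import Data.Integer.Solver using (module +-*-Solver)
open import Data.Rational as ℚ using (0ℚ; 1ℚ; toℚᵘ)
import Data.Rational.Properties as ℚP
import Data.Rational.Unnormalised as ℚᵘ
open import Data.Rational.Unnormalised using (mkℚᵘ; *≡*; *≤*)
import Data.Rational.Unnormalised.Properties as ℚᵘP
open import Function using (_∘_; id; Injection)
open import Relation.Nullary using (Dec; yes; no; ¬_)
open import Relation.Nullary.Decidable using (¬?; _×-dec_; _⊎-dec_; decidable-stable)
open import Relation.Unary using (Pred; Decidable; _⊆_; _∪_)
open import Relation.Binary.PropositionalEquality
open import Algebra.Properties.CommutativeMonoid.Sum ℕP.+-0-commutativeMonoid
  using (sum; sum-cong-≗; sum-permute; ∑-distrib-+; sum-replicate-zero)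

𝟙 : ∀ {p} {P : Set p} → Dec P → ℕ
𝟙 (yes _) = 1
𝟙 (no _)  = 0

𝟙-mono : ∀ {p q} {P : Set p} {Q : Set q} (P? : Dec P) (Q? : Dec Q) → (P → Q) → 𝟙 P? ℕ.≤ 𝟙 Q?
𝟙-mono (yes _) (yes _) P⇒Q = ℕP.≤-refl
𝟙-mono (yes p) (no ¬q) P⇒Q = ⊥-elim (¬q (P⇒Q p))
𝟙-mono (no _)  Q?      P⇒Q = z≤n

𝟙-no : ∀ {p} {P : Set p} (P? : Dec P) → ¬ P → 𝟙 P? ≡ 0
𝟙-no P? ¬p = ℕP.n≤0⇒n≡0 (𝟙-mono P? (no id) ¬p)

𝟙-⊎ : ∀ {p q r} {P : Set p} {Q : Set q} {R : Set r} (P? : Dec P) (Q? : Dec Q) (R? : Dec R) →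
      (P → Q ⊎ R) → 𝟙 P? ℕ.≤ 𝟙 Q? +ℕ 𝟙 R?
𝟙-⊎ (no _)  Q?      R?      P⇒Q⊎R = z≤n
𝟙-⊎ (yes _) (yes _) R?      P⇒Q⊎R = s≤s z≤n
𝟙-⊎ (yes _) (no _)  (yes _) P⇒Q⊎R = ℕP.≤-refl
𝟙-⊎ (yes p) (no ¬q) (no ¬r) P⇒Q⊎R with P⇒Q⊎R p
... | inj₁ q = ⊥-elim (¬q q)
... | inj₂ r = ⊥-elim (¬r r)

∣_∣ : ∀ {m} {P : Pred (Fin m) 0ℓ} → Decidable P → ℕ
∣ P? ∣ = sum (λ x → 𝟙 (P? x))

sum-mono-≤ : ∀ {m} {f g : Fin m → ℕ} → (∀ x → f x ℕ.≤ g x) → sum f ℕ.≤ sum g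
sum-mono-≤ {zero}  f≤g = z≤n
sum-mono-≤ {suc m} f≤g = ℕP.+-mono-≤ (f≤g zero) (sum-mono-≤ (f≤g ∘ suc))

count-tabulate : ∀ {n} {A : Set} {P : Pred A 0ℓ} (P? : Decidable P) (g : Fin n → A) →
                 count P? (tabulate g) ≡ ∣ (λ x → P? (g x)) ∣
count-tabulate {zero}  P? g = refl
count-tabulate {suc n} P? g with P? (g zero)
... | yes _ = cong suc (count-tabulate P? (g ∘ suc))
... | no _  = count-tabulate P? (g ∘ suc)

module _ {m : ℕ} {P : Pred (Fin m) 0ℓ} (P? : Decidable P) where

  ∣∣-∅ : (∀ x → ¬ P x) → ∣ P? ∣ ≡ 0
  ∣∣-∅ ¬P = trans (sum-cong-≗ (λ x → 𝟙-no (P? x) (¬P x))) (sum-replicate-zero m)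

  ∣∣-mono : {Q : Pred (Fin m) 0ℓ} (Q? : Decidable Q) → P ⊆ Q → ∣ P? ∣ ℕ.≤ ∣ Q? ∣
  ∣∣-mono Q? P⊆Q = sum-mono-≤ (λ x → 𝟙-mono (P? x) (Q? x) P⊆Q)

  ∣∣-∪ : {Q R : Pred (Fin m) 0ℓ} (Q? : Decidable Q) (R? : Decidable R) → P ⊆ Q ∪ R → ∣ P? ∣ ℕ.≤ ∣ Q? ∣ +ℕ ∣ R? ∣
  ∣∣-∪ Q? R? P⊆Q∪R = ℕP.≤-trans (sum-mono-≤ (λ x → 𝟙-⊎ (P? x) (Q? x) (R? x) P⊆Q∪R))
                                (ℕP.≤-reflexive (∑-distrib-+ {m} (λ x → 𝟙 (Q? x)) (λ x → 𝟙 (R? x))))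

  ∣∣-permute : (π : Permutation′ m) {f : Fin m → Fin m} → (∀ x → π ⟨$⟩ʳ x ≡ f x) →
               ∣ (λ x → P? (f x)) ∣ ≡ ∣ P? ∣
  ∣∣-permute π π≗f = trans (sum-cong-≗ (λ x → cong (λ y → 𝟙 (P? y)) (sym (π≗f x))))
                           (sym (sum-permute (λ x → 𝟙 (P? x)) π))

∣≟∣≡1 : ∀ {m} (a : Fin m) → ∣ (a ≟F_) ∣ ≡ 1
∣≟∣≡1 {suc m} zero = cong suc (∣∣-∅ {m} (λ x → zero ≟F suc x) (λ x ()))
∣≟∣≡1 {suc m} (suc a) = begin
  𝟙 (suc a ≟F zero) +ℕ sum (λ x → 𝟙 (suc a ≟F suc x)) ≡⟨ cong₂ _+ℕ_ (𝟙-no (suc a ≟F zero) (λ ()))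
                                                                 (sum-cong-≗ 𝟙-suc) ⟩
  ∣ (a ≟F_) ∣                                          ≡⟨ ∣≟∣≡1 a ⟩
  1                                                    ∎
  where
  open ≡-Reasoning
  𝟙-suc : ∀ x → 𝟙 (suc a ≟F suc x) ≡ 𝟙 (a ≟F x)
  𝟙-suc x = ℕP.≤-antisym (𝟙-mono (suc a ≟F suc x) (a ≟F x) suc-injective)
                         (𝟙-mono (a ≟F x) (suc a ≟F suc x) (cong suc))

∣≟×∣≤𝟙 : ∀ {m} {A : Set} (a : Fin m) (A? : Dec A) → ∣ (λ x → (a ≟F x) ×-dec A?) ∣ ℕ.≤ 𝟙 A?
∣≟×∣≤𝟙 a (yes _) = ℕP.≤-trans (∣∣-mono (λ x → (a ≟F x) ×-dec _) (a ≟F_) proj₁)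
                              (ℕP.≤-reflexive (∣≟∣≡1 a))
∣≟×∣≤𝟙 a (no ¬A) = ℕP.≤-reflexive (∣∣-∅ (λ x → (a ≟F x) ×-dec no ¬A) (λ x (_ , A) → ¬A A))

∣∣-image : ∀ {n m} (f : Fin n → Fin m) {Q : Pred (Fin n) 0ℓ} (Q? : Decidable Q)
           {R : Pred (Fin m) 0ℓ} (R? : Decidable R) →
           (∀ {x} → R x → ∃ λ ω → f ω ≡ x × Q ω) → ∣ R? ∣ ℕ.≤ ∣ Q? ∣
∣∣-image {zero} f Q? R? R⊆image =
  ℕP.≤-reflexive (∣∣-∅ R? (λ x Rx → ¬Fin0 (proj₁ (R⊆image Rx))))
∣∣-image {suc n} f Q? {R} R? R⊆image = begin
  ∣ R? ∣                    ≤⟨ ∣∣-∪ R? hit? rest? split ⟩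
  ∣ hit? ∣ +ℕ ∣ rest? ∣     ≤⟨ ℕP.+-mono-≤ (∣≟×∣≤𝟙 (f zero) (Q? zero))
                                            (∣∣-image (f ∘ suc) (Q? ∘ suc) rest? id) ⟩
  𝟙 (Q? zero) +ℕ ∣ Q? ∘ suc ∣ ∎
  where
  open ℕP.≤-Reasoning
  hit? = λ x → (f zero ≟F x) ×-dec Q? zero
  rest? = λ x → any? (λ ω → (f (suc ω) ≟F x) ×-dec Q? (suc ω))
  split : R ⊆ _ ∪ _
  split Rx with R⊆image Rx
  ... | zero  , fω≡x , Qω = inj₁ (fω≡x , Qω)
  ... | suc ω , fω≡x , Qω = inj₂ (ω , fω≡x , Qω)

toℚᵘ-/ : ∀ i d → toℚᵘ (i / suc d) ℚᵘ.≃ mkℚᵘ i d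
toℚᵘ-/ i d = ℚP.toℚᵘ-fromℚᵘ (mkℚᵘ i d)

/-distribʳ-+ : ∀ a b d → (+ (a +ℕ b)) / suc d ≡ (+ a) / suc d + (+ b) / suc d
/-distribʳ-+ a b d = ℚP.toℚᵘ-injective (begin
  toℚᵘ ((+ (a +ℕ b)) / suc d)                        ≈⟨ toℚᵘ-/ (+ (a +ℕ b)) d ⟩
  mkℚᵘ (+ (a +ℕ b)) d                                ≈⟨ *≡* cross ⟩
  mkℚᵘ (+ a) d ℚᵘ.+ mkℚᵘ (+ b) d                     ≈⟨ ℚᵘP.+-cong (toℚᵘ-/ (+ a) d) (toℚᵘ-/ (+ b) d) ⟨
  toℚᵘ ((+ a) / suc d) ℚᵘ.+ toℚᵘ ((+ b) / suc d)     ≈⟨ ℚP.toℚᵘ-homo-+ ((+ a) / suc d) ((+ b) / suc d) ⟨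
  toℚᵘ ((+ a) / suc d + (+ b) / suc d)               ∎)
  where
  open ℚᵘP.≃-Reasoning
  open +-*-Solver
  D = + suc d
  cross : + (a +ℕ b) ℤ.* + (suc d ℕ.* suc d) ≡ (+ a ℤ.* D ℤ.+ + b ℤ.* D) ℤ.* D
  cross rewrite ℤP.pos-+ a b | sym (ℤP.pos-* (suc d) (suc d)) =
    solve 3 (λ A B D → (A :+ B) :* (D :* D) := (A :* D :+ B :* D) :* D) refl (+ a) (+ b) D

/-mono-≤ : ∀ {a b n m} → a ℕ.≤ b → n ℕ.≤ m → (+ a) / suc m ≤ (+ b) / suc n
/-mono-≤ {a} {b} {n} {m} a≤b n≤m =
  ℚP.toℚᵘ-cancel-≤ (ℚᵘP.≤-respˡ-≃ (ℚᵘP.≃-sym (toℚᵘ-/ (+ a) m)) (ℚᵘP.≤-respʳ-≃ (ℚᵘP.≃-sym (toℚᵘ-/ (+ b) n))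
    (*≤* (subst₂ ℤ._≤_ (ℤP.pos-* a (suc n)) (ℤP.pos-* b (suc m))
                       (ℤ.+≤+ (ℕP.*-mono-≤ a≤b (s≤s n≤m)))))))

*-suc : ∀ j q → (+ suc j) / 1 * q ≡ q + (+ j) / 1 * q
*-suc j q = begin
  (+ (1 +ℕ j)) / 1 * q           ≡⟨ cong (_* q) (/-distribʳ-+ 1 j 0) ⟩
  (1ℚ + (+ j) / 1) * q           ≡⟨ ℚP.*-distribʳ-+ q 1ℚ ((+ j) / 1) ⟩
  1ℚ * q + (+ j) / 1 * q         ≡⟨ cong (_+ (+ j) / 1 * q) (ℚP.*-identityˡ q) ⟩
  q + (+ j) / 1 * q              ∎
  where open ≡-Reasoning

Pr-suc : ∀ {m} {P : Pred (Fin (suc m)) 0ℓ} (P? : Decidable P) → Pr (suc m) P? ≡ (+ ∣ P? ∣) / suc m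
Pr-suc {m} P? = cong (λ c → (+ c) / suc m) (count-tabulate P? id)

Pr-∅ : ∀ {m} {P : Pred (Fin m) 0ℓ} (P? : Decidable P) → (∀ x → ¬ P x) → Pr m P? ≡ 0ℚ
Pr-∅ {zero}  P? ¬P = refl
Pr-∅ {suc m} P? ¬P = begin
  Pr (suc m) P?       ≡⟨ Pr-suc P? ⟩
  (+ ∣ P? ∣) / suc m  ≡⟨ cong (λ c → (+ c) / suc m) (∣∣-∅ P? ¬P) ⟩
  (+ 0) / suc m       ≡⟨ ℚP.0/n≡0 (suc m) ⟩
  0ℚ                  ∎
  where open ≡-Reasoning

Pr-∪ : ∀ {m} {P Q R : Pred (Fin m) 0ℓ} (P? : Decidable P) (Q? : Decidable Q) (R? : Decidable R) →
       P ⊆ Q ∪ R → Pr m P? ≤ Pr m Q? + Pr m R?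
Pr-∪ {zero}  P? Q? R? P⊆Q∪R = ℚP.≤-refl
Pr-∪ {suc m} P? Q? R? P⊆Q∪R = begin
  Pr (suc m) P?                                ≡⟨ Pr-suc P? ⟩
  (+ ∣ P? ∣) / suc m                           ≤⟨ /-mono-≤ (∣∣-∪ P? Q? R? P⊆Q∪R) ℕP.≤-refl ⟩
  (+ (∣ Q? ∣ +ℕ ∣ R? ∣)) / suc m               ≡⟨ /-distribʳ-+ ∣ Q? ∣ ∣ R? ∣ m ⟩
  (+ ∣ Q? ∣) / suc m + (+ ∣ R? ∣) / suc m      ≡⟨ cong₂ _+_ (Pr-suc Q?) (Pr-suc R?) ⟨
  Pr (suc m) Q? + Pr (suc m) R?                ∎
  where open ℚP.≤-Reasoning

Pr-permute : ∀ {m} {P : Pred (Fin m) 0ℓ} (P? : Decidable P) (π : Permutation′ m) {f : Fin m → Fin m} →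
             (∀ x → π ⟨$⟩ʳ x ≡ f x) → Pr m (λ x → P? (f x)) ≡ Pr m P?
Pr-permute {zero}  P? π π≗f = refl
Pr-permute {suc m} P? π {f} π≗f = begin
  Pr (suc m) (λ x → P? (f x))  ≡⟨ Pr-suc (λ x → P? (f x)) ⟩
  _                            ≡⟨ cong (λ c → (+ c) / suc m) (∣∣-permute P? π π≗f) ⟩
  (+ ∣ P? ∣) / suc m           ≡⟨ Pr-suc P? ⟨
  Pr (suc m) P?                ∎
  where open ≡-Reasoning

Pr-image : ∀ {n m} (f : Fin n → Fin m) → n ℕ.≤ m →
           {Q : Pred (Fin n) 0ℓ} (Q? : Decidable Q) {R : Pred (Fin m) 0ℓ} (R? : Decidable R) →
           (∀ {x} → R x → ∃ λ ω → f ω ≡ x × Q ω) → Pr m R? ≤ Pr n Q?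
Pr-image {zero}  {zero}  f n≤m Q? R? R⊆image = ℚP.≤-refl
Pr-image {zero}  {suc m} f n≤m Q? R? R⊆image = begin
  Pr (suc m) R?       ≡⟨ Pr-suc R? ⟩
  (+ ∣ R? ∣) / suc m  ≤⟨ /-mono-≤ (∣∣-image f Q? R? R⊆image) ℕP.≤-refl ⟩
  (+ 0) / suc m       ≡⟨ ℚP.0/n≡0 (suc m) ⟩
  0ℚ                  ∎
  where open ℚP.≤-Reasoning
Pr-image {suc n} {suc m} f n≤m Q? R? R⊆image = begin
  Pr (suc m) R?       ≡⟨ Pr-suc R? ⟩
  (+ ∣ R? ∣) / suc m  ≤⟨ /-mono-≤ (∣∣-image f Q? R? R⊆image) (ℕ.s≤s⁻¹ n≤m) ⟩
  (+ ∣ Q? ∣) / suc n  ≡⟨ Pr-suc Q? ⟨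
  Pr (suc n) Q?       ∎
  where open ℚP.≤-Reasoning

maxℚ-nonneg : ∀ xs → 0ℚ ≤ maxℚ xs
maxℚ-nonneg []       = ℚP.≤-refl
maxℚ-nonneg (x ∷ xs) = ℚP.≤-trans (maxℚ-nonneg xs) (ℚP.p≤q⊔p x (maxℚ xs))

module _ {A : Set} (f : A → ℚ) where

  maxℚ-map-ub : ∀ {x xs} → x ∈ xs → f x ≤ maxℚ (map f xs)
  maxℚ-map-ub {xs = y ∷ ys} (here refl) = ℚP.p≤p⊔q (f y) (maxℚ (map f ys))
  maxℚ-map-ub {xs = y ∷ ys} (there x∈ys) =
    ℚP.≤-trans (maxℚ-map-ub x∈ys) (ℚP.p≤q⊔p (f y) (maxℚ (map f ys)))

  maxℚ-map-lub : ∀ {b} xs → 0ℚ ≤ b → (∀ {x} → x ∈ xs → f x ≤ b) → maxℚ (map f xs) ≤ b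
  maxℚ-map-lub []       0≤b ub = 0≤b
  maxℚ-map-lub (x ∷ xs) 0≤b ub = ℚP.⊔-lub (ub (here refl)) (maxℚ-map-lub xs 0≤b (ub ∘ there))

maxℕ-map-ub : ∀ {A : Set} (f : A → ℕ) {x xs} → x ∈ xs → f x ℕ.≤ maxℕ (map f xs)
maxℕ-map-ub f {xs = y ∷ ys} (here refl)  = ℕP.m≤m⊔n (f y) (maxℕ (map f ys))
maxℕ-map-ub f {xs = y ∷ ys} (there x∈ys) =
  ℕP.≤-trans (maxℕ-map-ub f x∈ys) (ℕP.m≤n⊔m (f y) (maxℕ (map f ys)))

letter : ∀ {k n} → (Fin k → Sym n) → Fin k × Bool → Sym n
letter φ (s , true)  = φ s
letter φ (s , false) = Perm.flip (φ s)

act-∷ : ∀ {k n} (φ : Fin k → Sym n) l w x → act φ (l ∷ w) x ≡ letter φ l ⟨$⟩ʳ act φ w x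
act-∷ φ (s , true)  w x = refl
act-∷ φ (s , false) w x = refl

wordPerm : ∀ {k n} → (Fin k → Sym n) → Word k → Sym n
wordPerm φ []      = Perm.id
wordPerm φ (l ∷ w) = wordPerm φ w ∘ₚ letter φ l

wordPerm-⟨$⟩ʳ : ∀ {k n} (φ : Fin k → Sym n) w x → wordPerm φ w ⟨$⟩ʳ x ≡ act φ w x
wordPerm-⟨$⟩ʳ φ []      x = refl
wordPerm-⟨$⟩ʳ φ (l ∷ w) x = trans (cong (letter φ l ⟨$⟩ʳ_) (wordPerm-⟨$⟩ʳ φ w x)) (sym (act-∷ φ l w x))

moved? : ∀ {k n} (φ : Fin k → Sym n) (w : Word k) → Decidable (λ x → ¬ act φ w x ≡ x)
moved? φ w x = ¬? (act φ w x ≟F x)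

extAct≡just⇒lift : ∀ {n m} (ι : Fin n ↣ Fin m) (σ : Sym n) {⋆ y} → extAct ι σ ⋆ ≡ just y →
                   ∃ λ ω → Injection.to ι ω ≡ ⋆ × Injection.to ι (σ ⟨$⟩ʳ ω) ≡ y
extAct≡just⇒lift ι σ {⋆} eq with any? (λ ω → Injection.to ι ω ≟F ⋆)
extAct≡just⇒lift ι σ refl | yes (ω , ιω≡⋆) = ω , ιω≡⋆ , refl

-- Trajectories under a perturbation

module Perturbation {k n m : ℕ} (ι : Fin n ↣ Fin m) (φ : Fin k → Sym n) (ψ : Fin k → Sym m) where

  open Injection ι using (injective) renaming (to to ι⟨_⟩)

  Disagree : Fin k → Pred (Fin m) 0ℓ
  Disagree s ⋆ = ¬ extAct ι (φ s) ⋆ ≡ just (ψ s ⟨$⟩ʳ ⋆)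

  disagree? : ∀ s → Decidable (Disagree s)
  disagree? s ⋆ = ¬? (MaybeP.≡-dec _≟F_ (extAct ι (φ s) ⋆) (just (ψ s ⟨$⟩ʳ ⋆)))

  agree : ∀ s {⋆} → ¬ Disagree s ⋆ → extAct ι (φ s) ⋆ ≡ just (ψ s ⟨$⟩ʳ ⋆)
  agree s {⋆} = decidable-stable (MaybeP.≡-dec _≟F_ (extAct ι (φ s) ⋆) (just (ψ s ⟨$⟩ʳ ⋆)))

  -- The letter s⁻¹ at y traverses the ψ s-edge from ψ s⁻¹ y to y.
  DisagreeAt : Fin k × Bool → Pred (Fin m) 0ℓ
  DisagreeAt (s , true)  y = Disagree s y
  DisagreeAt (s , false) y = Disagree s (ψ s ⟨$⟩ˡ y)

  disagreeAt? : ∀ l → Decidable (DisagreeAt l)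
  disagreeAt? (s , true)  y = disagree? s y
  disagreeAt? (s , false) y = disagree? s (ψ s ⟨$⟩ˡ y)

  Pr-disagreeAt : ∀ s b → Pr m (disagreeAt? (s , b)) ≡ dH ι (φ s) (ψ s)
  Pr-disagreeAt s true  = refl
  Pr-disagreeAt s false = Pr-permute (disagree? s) (Perm.flip (ψ s)) (λ _ → refl)

  agreeAt⇒preimage : ∀ l {y} → ¬ DisagreeAt l y → ∃ λ ω → ι⟨ ω ⟩ ≡ y
  agreeAt⇒preimage (s , true) ¬d with extAct≡just⇒lift ι (φ s) (agree s ¬d)
  ... | ω , ιω≡y , _ = ω , ιω≡y
  agreeAt⇒preimage (s , false) ¬d with extAct≡just⇒lift ι (φ s) (agree s ¬d)
  ... | ω , _ , ιφω≡ψψ⁻¹y = φ s ⟨$⟩ʳ ω , trans ιφω≡ψψ⁻¹y (Perm.inverseʳ (ψ s))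

  agreeAt⇒commute : ∀ l {y ω} → ¬ DisagreeAt l y → ι⟨ ω ⟩ ≡ y →
                    letter ψ l ⟨$⟩ʳ y ≡ ι⟨ letter φ l ⟨$⟩ʳ ω ⟩
  agreeAt⇒commute (s , true) ¬d ιω≡y with extAct≡just⇒lift ι (φ s) (agree s ¬d)
  ... | ω′ , ιω′≡y , ιφω′≡ψy =
    trans (sym ιφω′≡ψy) (cong (λ v → ι⟨ φ s ⟨$⟩ʳ v ⟩) (injective (trans ιω′≡y (sym ιω≡y))))
  agreeAt⇒commute (s , false) {ω = ω} ¬d ιω≡y with extAct≡just⇒lift ι (φ s) (agree s ¬d)
  ... | ω′ , ιω′≡ψ⁻¹y , ιφω′≡ψψ⁻¹y = trans (sym ιω′≡ψ⁻¹y) (cong ι⟨_⟩ ω′≡φ⁻¹ω)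
    where
    φω′≡ω : φ s ⟨$⟩ʳ ω′ ≡ ω
    φω′≡ω = injective (trans ιφω′≡ψψ⁻¹y (trans (Perm.inverseʳ (ψ s)) (sym ιω≡y)))
    ω′≡φ⁻¹ω : ω′ ≡ φ s ⟨$⟩ˡ ω
    ω′≡φ⁻¹ω = trans (sym (Perm.inverseˡ (φ s))) (cong (φ s ⟨$⟩ˡ_) φω′≡ω)

  DisagreesAlong : Word k → Pred (Fin m) 0ℓ
  DisagreesAlong []      x = ⊥
  DisagreesAlong (l ∷ w) x = DisagreeAt l (act ψ w x) ⊎ DisagreesAlong w x

  disagreesAlong? : ∀ w → Decidable (DisagreesAlong w)
  disagreesAlong? []      x = no id
  disagreesAlong? (l ∷ w) x = disagreeAt? l (act ψ w x) ⊎-dec disagreesAlong? w x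

  agreeing⇒preimage : ∀ l w {x} → ¬ DisagreesAlong (l ∷ w) x → ∃ λ ω → ι⟨ ω ⟩ ≡ x
  agreeing⇒preimage l []       ¬d = agreeAt⇒preimage l (¬d ∘ inj₁)
  agreeing⇒preimage l (l′ ∷ w) ¬d = agreeing⇒preimage l′ w (¬d ∘ inj₂)

  agreeing⇒commute : ∀ w {x ω} → ¬ DisagreesAlong w x → ι⟨ ω ⟩ ≡ x → act ψ w x ≡ ι⟨ act φ w ω ⟩
  agreeing⇒commute []      ¬d ιω≡x = sym ιω≡x
  agreeing⇒commute (l ∷ w) {x} {ω} ¬d ιω≡x = begin
    act ψ (l ∷ w) x                 ≡⟨ act-∷ ψ l w x ⟩
    letter ψ l ⟨$⟩ʳ act ψ w x       ≡⟨ agreeAt⇒commute l (¬d ∘ inj₁) (sym (agreeing⇒commute w (¬d ∘ inj₂) ιω≡x)) ⟩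
    ι⟨ letter φ l ⟨$⟩ʳ act φ w ω ⟩  ≡⟨ cong ι⟨_⟩ (act-∷ φ l w ω) ⟨
    ι⟨ act φ (l ∷ w) ω ⟩            ∎
    where open ≡-Reasoning

  moved⇒disagrees⊎lifted : ∀ w {x} → ¬ act ψ w x ≡ x →
                           DisagreesAlong w x ⊎ ∃ λ ω → ι⟨ ω ⟩ ≡ x × ¬ act φ w ω ≡ ω
  moved⇒disagrees⊎lifted w {x} moved with disagreesAlong? w x
  ... | yes d = inj₁ d
  moved⇒disagrees⊎lifted []      moved | no ¬d = ⊥-elim (moved refl)
  moved⇒disagrees⊎lifted (l ∷ w) {x} moved | no ¬d with agreeing⇒preimage l w ¬d
  ... | ω , ιω≡x = inj₂ (ω , ιω≡x , λ fixed → moved (begin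
    act ψ (l ∷ w) x       ≡⟨ agreeing⇒commute (l ∷ w) ¬d ιω≡x ⟩
    ι⟨ act φ (l ∷ w) ω ⟩  ≡⟨ cong ι⟨_⟩ fixed ⟩
    ι⟨ ω ⟩                ≡⟨ ιω≡x ⟩
    x                     ∎))
    where open ≡-Reasoning

  module _ {ε : ℚ} (dH≤ε : ∀ s → dH ι (φ s) (ψ s) ≤ ε) where

    Pr-disagreesAlong≤ : ∀ w → Pr m (disagreesAlong? w) ≤ (+ length w) / 1 * ε
    Pr-disagreesAlong≤ [] = ℚP.≤-reflexive (trans (Pr-∅ (disagreesAlong? []) (λ _ → id)) (sym (ℚP.*-zeroˡ ε)))
    Pr-disagreesAlong≤ ((s , b) ∷ w) = begin
      Pr m (disagreesAlong? ((s , b) ∷ w))                       ≤⟨ Pr-∪ _ _ (disagreesAlong? w) id ⟩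
      Pr m (λ x → disagreeAt? (s , b) (act ψ w x)) + Pr m (disagreesAlong? w)
                    ≡⟨ cong (_+ Pr m (disagreesAlong? w))
                            (Pr-permute (disagreeAt? (s , b)) (wordPerm ψ w) (wordPerm-⟨$⟩ʳ ψ w)) ⟩
      Pr m (disagreeAt? (s , b)) + Pr m (disagreesAlong? w)
                    ≡⟨ cong (_+ Pr m (disagreesAlong? w)) (Pr-disagreeAt s b) ⟩
      dH ι (φ s) (ψ s) + Pr m (disagreesAlong? w)                ≤⟨ ℚP.+-mono-≤ (dH≤ε s) (Pr-disagreesAlong≤ w) ⟩
      ε + (+ length w) / 1 * ε                                   ≡⟨ *-suc (length w) ε ⟨
      (+ suc (length w)) / 1 * ε                                 ∎
      where open ℚP.≤-Reasoning

    Pr-moved≤ : ∀ r → Pr m (moved? ψ r) ≤ Pr n (moved? φ r) + (+ length r) / 1 * ε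
    Pr-moved≤ r = begin
      Pr m (moved? ψ r)                                          ≤⟨ Pr-∪ (moved? ψ r) (disagreesAlong? r) lifted?
                                                                         (moved⇒disagrees⊎lifted r) ⟩
      Pr m (disagreesAlong? r) + Pr m lifted?                    ≤⟨ ℚP.+-mono-≤ (Pr-disagreesAlong≤ r)
                                                                      (Pr-image ι⟨_⟩ (injective⇒≤ injective)
                                                                         (moved? φ r) lifted? id) ⟩
      (+ length r) / 1 * ε + Pr n (moved? φ r)                   ≡⟨ ℚP.+-comm ((+ length r) / 1 * ε) (Pr n (moved? φ r)) ⟩
      Pr n (moved? φ r) + (+ length r) / 1 * ε                   ∎
      where
      open ℚP.≤-Reasoning
      lifted? = λ x → any? (λ ω → (ι⟨ ω ⟩ ≟F x) ×-dec moved? φ r ω)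

claim2p1 : (P : Presentation) {n m : ℕ} (ι : Fin n ↣ Fin m)
    (φ : Fin (gens P) → Sym n) (ψ : Fin (gens P) → Sym m) (ε₁ ε₂ : ℚ) →
    AlmostAction P ε₁ φ → dHmap ι φ ψ ≤ ε₂ →
    AlmostAction P (ε₁ + ((+ (maxRelLength P +ℕ 1)) / 1) * ε₂) ψ
claim2p1 P {n} {m} ι φ ψ ε₁ ε₂ φ-almost φψ-close =
  maxℚ-map-lub (λ r → Pr m (moved? ψ r)) (rels P) bound-nonneg relator-bound
  where
  open Perturbation ι φ ψ using (Pr-moved≤)
  open ℚP.≤-Reasoning

  instance
    ε₂-nonneg : ℚ.NonNegative ε₂
    ε₂-nonneg = ℚ.nonNegative (ℚP.≤-trans (maxℚ-nonneg (map (λ s → dH ι (φ s) (ψ s)) (List.allFin (gens P)))) φψ-close)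

  dH≤ε₂ : ∀ s → dH ι (φ s) (ψ s) ≤ ε₂
  dH≤ε₂ s = ℚP.≤-trans (maxℚ-map-ub (λ s → dH ι (φ s) (ψ s)) (∈-allFin s)) φψ-close

  scale-mono : ∀ {i j} → i ℕ.≤ j → (+ i) / 1 * ε₂ ≤ (+ j) / 1 * ε₂
  scale-mono i≤j = ℚP.*-monoʳ-≤-nonNeg ε₂ (/-mono-≤ i≤j z≤n)

  bound-nonneg : 0ℚ ≤ ε₁ + (+ (maxRelLength P +ℕ 1)) / 1 * ε₂
  bound-nonneg = ℚP.+-mono-≤ (ℚP.≤-trans (maxℚ-nonneg (map (λ r → Pr n (moved? φ r)) (rels P))) φ-almost)
                             (ℚP.≤-trans (ℚP.≤-reflexive (sym (ℚP.*-zeroˡ ε₂))) (scale-mono {0} {maxRelLength P +ℕ 1} z≤n))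

  relator-bound : ∀ {r} → r ∈ rels P → Pr m (moved? ψ r) ≤ ε₁ + (+ (maxRelLength P +ℕ 1)) / 1 * ε₂
  relator-bound {r} r∈rels = begin
    Pr m (moved? ψ r)                              ≤⟨ Pr-moved≤ dH≤ε₂ r ⟩
    Pr n (moved? φ r) + (+ length r) / 1 * ε₂      ≤⟨ ℚP.+-mono-≤
      (ℚP.≤-trans (maxℚ-map-ub (λ r → Pr n (moved? φ r)) r∈rels) φ-almost)
      (scale-mono (ℕP.m≤n⇒m≤n+o 1 (maxℕ-map-ub length r∈rels))) ⟩
    ε₁ + (+ (maxRelLength P +ℕ 1)) / 1 * ε₂        ∎
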